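{- Let $n\ge4$ and let $S$ be a cyclic strategy of length $n$. Then exactly one permutation $\pi\in S_n$ has the property that the game with strategy $S$ and secret $\pi$ ends after exactly three guesses and $\rho_S(\pi)=3$.
   Context: Permutation wordle on $[n]=\{1,\dots,n\}$: a secret permutation $\pi\in S_n$ (one-line notation) is fixed. The first guess is $\gamma_1=[1,2,\dots,n]$. After guess $\gamma_r$ the guesser learns $\mathcal{J}_r=\{i:\gamma_r(i)=\pi(i)\}$; $\mathcal{I}_r=[n]\setminus\mathcal{J}_r$. The game ends at the first $r$ with $\mathcal{J}_r=[n]$. A strategy of length $n$ is a sequence $S=(S[1],\dots,S[n])$ with $S[k]$ a permutation of $[k]$; if $\mathcal{I}_r=\{i_1<\dots<i_k\}\neq\emptyset$ and $\sigma=S[k]$, then $\gamma_{r+1}(i)=\gamma_r(i)$ for $i\in\mathcal{J}_r$ and $\gamma_{r+1}(i_{\sigma(j)})=\gamma_r(i_j)$ for $j=1,\dots,k$. A cyclic strategy is one in which every component $S[k]$ is a cyclic permutation of $[k]$ (a single $k$-cycle). For a secret $\pi$, $\rho_S(\pi)=\min\{i:\mathcal{J}_i\neq\emptyset\}$. -}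

module Defs where

open import Data.Nat using (ℕ; zero; suc; _≤_; _<_)
open import Data.Nat.Properties using (≤-trans; ≤-reflexive)
open import Data.Fin using (Fin; _≟_)
open import Data.Fin.Permutation using (Permutation′; _⟨$⟩ʳ_; _⟨$⟩ˡ_)
open import Data.List using (List; []; _∷_; length; filter; allFin; lookup; map)
open import Data.List.Properties using (length-filter; length-tabulate)
open import Data.Product using (_×_; _,_; ∃; proj₁; proj₂)
open import Relation.Nullary using (¬_; ¬?; yes; no)
open import Relation.Binary.PropositionalEquality using (_≡_)
open import Function using (id)

-- A strategy of length n: for each k ≤ n a permutation S[k] of Fin k.
-- (The component S[0] is a permutation of the empty set, hence unique
-- and irrelevant; it is never used since the game stops when I_r = ∅.)
Strategy : ℕ → Set
Strategy n = (k : ℕ) → k ≤ n → Permutation′ k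

iter : {k : ℕ} → Permutation′ k → ℕ → Fin k → Fin k
iter σ zero    i = i
iter σ (suc m) i = σ ⟨$⟩ʳ (iter σ m i)

-- σ is a single k-cycle: every element lies in the orbit of every element.
IsCyclic : {k : ℕ} → Permutation′ k → Set
IsCyclic {k} σ = (i j : Fin k) → ∃ λ m → iter σ m i ≡ j

CyclicStrategy : {n : ℕ} → Strategy n → Set
CyclicStrategy {n} S = (k : ℕ) → (1 ≤ k) → (p : k ≤ n) → IsCyclic (S k p)

Guess : ℕ → Set
Guess n = Fin n → Fin n

module _ {n : ℕ} (S : Strategy n) (π : Permutation′ n) where

  -- I_r = indices where the guess is wrong, listed in increasing order
  wrong : Guess n → List (Fin n)
  wrong γ = filter (λ i → ¬? (γ i ≟ π ⟨$⟩ʳ i)) (allFin n)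

  wrong-len : (γ : Guess n) → length (wrong γ) ≤ n
  wrong-len γ = ≤-trans (length-filter (λ i → ¬? (γ i ≟ π ⟨$⟩ʳ i)) (allFin n))
                        (≤-reflexive (length-tabulate id))

  assoc : List (Fin n × Fin n) → Fin n → Fin n → Fin n
  assoc []              x d = d
  assoc ((y , v) ∷ ys) x d with y ≟ x
  ... | yes _ = v
  ... | no  _ = assoc ys x d

  -- the next guess: with I_r = {i_1 < ... < i_k} and σ = S[k],
  -- γ'(i_{σ(j)}) = γ(i_j), and γ' = γ on J_r.
  step : Guess n → Guess n
  step γ x = assoc (map (λ j → (e (σ ⟨$⟩ʳ j) , γ (e j))) (allFin k)) x (γ x)
    where
      k : ℕ
      k = length (wrong γ)
      e : Fin k → Fin n
      e = lookup (wrong γ)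
      σ : Permutation′ k
      σ = S k (wrong-len γ)

  -- guess r = γ_r for r ≥ 1 (1-indexed); γ_1 = identity. (guess 0 is unused.)
  guess : ℕ → Guess n
  guess zero = id
  guess (suc zero) = id
  guess (suc (suc r)) = step (guess (suc r))

  AllCorrect : ℕ → Set
  AllCorrect r = (i : Fin n) → guess r i ≡ π ⟨$⟩ʳ i

  SomeCorrect : ℕ → Set
  SomeCorrect r = ∃ λ i → guess r i ≡ π ⟨$⟩ʳ i

  EndsAt : ℕ → Set
  EndsAt m = AllCorrect m × ((r : ℕ) → 1 ≤ r → r < m → ¬ AllCorrect r)

  RhoIs : ℕ → Set
  RhoIs m = SomeCorrect m × ((r : ℕ) → 1 ≤ r → r < m → ¬ SomeCorrect r)

_≈ₚ_ : {n : ℕ} → Permutation′ n → Permutation′ n → Set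
_≈ₚ_ {n} π τ = (i : Fin n) → π ⟨$⟩ʳ i ≡ τ ⟨$⟩ʳ i

module Submission where

open import Defs
open import Data.Nat using (ℕ; zero; suc; _≤_; _<_; z≤n; s≤s)
open import Data.Nat.Properties using (≤-irrelevant; ≤-reflexive; ≤-refl)
open import Data.Fin using (Fin; cast; _≟_) renaming (zero to fzero; suc to fsuc)
open import Data.Fin.Properties using (cast-involutive)
open import Data.Fin.Permutation
  using (Permutation; Permutation′; _⟨$⟩ʳ_; _⟨$⟩ˡ_; permutation; inverseˡ; inverseʳ; flip; _∘ₚ_)
open import Data.List using (List; _∷_; length; allFin; lookup; map)
open import Data.List.Properties using (length-tabulate; lookup-tabulate; filter-all)
open import Data.List.Relation.Unary.Any using (here; there)
open import Data.List.Relation.Unary.All.Properties using (tabulate⁺)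
open import Data.List.Membership.Propositional using (_∈_)
open import Data.List.Membership.Propositional.Properties using (∈-allFin)
open import Data.Product using (∃; ∃!; _×_; _,_)
open import Data.Sum using (_⊎_; inj₁; inj₂)
open import Data.Empty using (⊥-elim)
open import Function using (id)
open import Function.Definitions using (Injective)
open import Relation.Nullary using (¬_; ¬?; yes; no)
open import Relation.Binary.PropositionalEquality using (_≡_; _≢_; refl; sym; trans; cong; subst; module ≡-Reasoning)

-- While every position of the guess is wrong, the strategy applies the same
-- n-cycle τ = S[n] to the whole guess, so γ₂ = τ⁻¹ and γ₃ = τ⁻² (identifying
-- positions of the list allFin n with elements of Fin n). Hence the secret is
-- forced to be τ⁻², and conversely τ⁻² misses in rounds 1 and 2 exactly
-- because τ² has no fixed point, which holds for any cycle of length ≥ 3.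

⟨$⟩ʳ-injective : ∀ {m n} (ρ : Permutation m n) → Injective _≡_ _≡_ (ρ ⟨$⟩ʳ_)
⟨$⟩ʳ-injective ρ p = trans (sym (inverseˡ ρ)) (trans (cong (ρ ⟨$⟩ˡ_) p) (inverseˡ ρ))

∀-by-⟨$⟩ʳ : ∀ {m n} (ρ : Permutation m n) (P : Fin n → Set) → (∀ j → P (ρ ⟨$⟩ʳ j)) → ∀ x → P x
∀-by-⟨$⟩ʳ ρ P h x = subst P (inverseʳ ρ) (h (ρ ⟨$⟩ˡ x))

module _ {k : ℕ} {σ : Permutation′ k} where

  iter-period₂ : ∀ {j} → σ ⟨$⟩ʳ (σ ⟨$⟩ʳ j) ≡ j → ∀ m → iter σ m j ≡ j ⊎ iter σ m j ≡ σ ⟨$⟩ʳ j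
  iter-period₂ p zero = inj₁ refl
  iter-period₂ p (suc m) with iter-period₂ p m
  ... | inj₁ q = inj₂ (cong (σ ⟨$⟩ʳ_) q)
  ... | inj₂ q = inj₁ (trans (cong (σ ⟨$⟩ʳ_) q) p)

  cyclic-period₂⇒orbit : IsCyclic σ → ∀ {j} → σ ⟨$⟩ʳ (σ ⟨$⟩ʳ j) ≡ j → ∀ i → i ≡ j ⊎ i ≡ σ ⟨$⟩ʳ j
  cyclic-period₂⇒orbit cyclic {j} p i with cyclic j i
  ... | m , q with iter-period₂ p m
  ... | inj₁ r = inj₁ (trans (sym q) r)
  ... | inj₂ r = inj₂ (trans (sym q) r)

no-pair-covers-Fin3+ : ∀ {k} (a b : Fin (suc (suc (suc k)))) → ¬ (∀ i → i ≡ a ⊎ i ≡ b)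
no-pair-covers-Fin3+ a b cover
  with cover fzero | cover (fsuc fzero) | cover (fsuc (fsuc fzero))
... | inj₁ refl | inj₁ ()   | _
... | inj₁ refl | inj₂ refl | inj₁ ()
... | inj₁ refl | inj₂ refl | inj₂ ()
... | inj₂ refl | inj₂ ()   | _
... | inj₂ refl | inj₁ refl | inj₁ ()
... | inj₂ refl | inj₁ refl | inj₂ ()

cyclic⇒square-fixedPointFree : ∀ {k} {σ : Permutation′ (suc (suc (suc k)))} → IsCyclic σ →
  ∀ j → σ ⟨$⟩ʳ (σ ⟨$⟩ʳ j) ≢ j
cyclic⇒square-fixedPointFree cyclic j p = no-pair-covers-Fin3+ _ _ (cyclic-period₂⇒orbit cyclic p)

below-3 : {P : ℕ → Set} → P 1 → P 2 → ∀ r → 1 ≤ r → r < 3 → P r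
below-3 p₁ p₂ 1 _ _ = p₁
below-3 p₁ p₂ 2 _ _ = p₂
below-3 p₁ p₂ (suc (suc (suc r))) _ (s≤s (s≤s (s≤s ())))

endsAt×rhoIs : ∀ {n} {S : Strategy n} {π : Permutation′ n} {m} → Fin n → AllCorrect S π m →
  (∀ r → 1 ≤ r → r < m → ¬ SomeCorrect S π r) → EndsAt S π m × RhoIs S π m
endsAt×rhoIs i hit miss = (hit , λ r 1≤r r<m all → miss r 1≤r r<m (i , all i)) , ((i , hit i) , miss)

module _ {n : ℕ} (S : Strategy n) where

  -- On a full miss the game uses S at length (allFin n), which is n only
  -- propositionally; allFin-lookup transports positions back to Fin n.
  private
    N : ℕ
    N = length (allFin n)

    N≡n : N ≡ n
    N≡n = length-tabulate id

  N≤n : N ≤ n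
  N≤n = ≤-reflexive N≡n

  lookup-allFin-cast : ∀ j → lookup (allFin n) j ≡ cast N≡n j
  lookup-allFin-cast j =
    trans (cong (lookup (allFin n)) (sym (cast-involutive (sym N≡n) N≡n j)))
          (lookup-tabulate id (cast N≡n j))

  allFin-lookup : Permutation N n
  allFin-lookup = permutation (lookup (allFin n)) (cast (sym N≡n))
    (lookup-tabulate id)
    (λ j → trans (cong (cast (sym N≡n)) (lookup-allFin-cast j)) (cast-involutive (sym N≡n) N≡n j))

  E : Fin N → Fin n
  E = allFin-lookup ⟨$⟩ʳ_

  τ : Permutation′ N
  τ = S N N≤n

  τ²E : Permutation N n
  τ²E = τ ∘ₚ τ ∘ₚ allFin-lookup

  module _ (π : Permutation′ n) where

    Misses : Guess n → Set
    Misses γ = ¬ ∃ λ i → γ i ≡ π ⟨$⟩ʳ i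

    wrong-misses : ∀ γ → Misses γ → wrong S π γ ≡ allFin n
    wrong-misses γ miss = filter-all (λ i → ¬? (γ i ≟ π ⟨$⟩ʳ i)) (tabulate⁺ (λ i p → miss (i , p)))

    assoc-map : ∀ {A : Set} (f : A → Fin n) → Injective _≡_ _≡_ f → (g : A → Fin n) →
      ∀ {xs j} → j ∈ xs → ∀ d → assoc S π (map (λ i → (f i , g i)) xs) (f j) d ≡ g j
    assoc-map f f-inj g {y ∷ xs} {j} j∈ d with f y ≟ f j
    assoc-map f f-inj g {y ∷ xs} {j} j∈          d | yes p = cong g (f-inj p)
    assoc-map f f-inj g {y ∷ xs} {j} (here refl) d | no ¬p = ⊥-elim (¬p refl)
    assoc-map f f-inj g {y ∷ xs} {j} (there j∈) d | no ¬p = assoc-map f f-inj g j∈ d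

    -- wrong γ also occurs inside the proof wrong-len γ, so it can only be
    -- replaced by allFin n after generalising over both.
    step-misses : ∀ γ → Misses γ → ∀ j → step S π γ (E (τ ⟨$⟩ʳ j)) ≡ γ (E j)
    step-misses γ miss j = go (wrong S π γ) (wrong-len S π γ) (wrong-misses γ miss)
      where
        go : (L : List (Fin n)) (q : length L ≤ n) → L ≡ allFin n →
          assoc S π (map (λ i → (lookup L (S (length L) q ⟨$⟩ʳ i) , γ (lookup L i))) (allFin (length L)))
            (E (τ ⟨$⟩ʳ j)) (γ (E (τ ⟨$⟩ʳ j)))
            ≡ γ (E j)
        go _ q refl rewrite ≤-irrelevant q N≤n =
          assoc-map (λ i → E (τ ⟨$⟩ʳ i)) (λ p → ⟨$⟩ʳ-injective τ (⟨$⟩ʳ-injective allFin-lookup p))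
            (λ i → γ (E i)) (∈-allFin j) _

    guess₃-misses : ¬ SomeCorrect S π 1 → ¬ SomeCorrect S π 2 → ∀ j → guess S π 3 (τ²E ⟨$⟩ʳ j) ≡ E j
    guess₃-misses miss₁ miss₂ j = begin
      guess S π 3 (E (τ ⟨$⟩ʳ (τ ⟨$⟩ʳ j))) ≡⟨ step-misses (guess S π 2) miss₂ (τ ⟨$⟩ʳ j) ⟩
      guess S π 2 (E (τ ⟨$⟩ʳ j))         ≡⟨ step-misses id miss₁ j ⟩
      E j                                ∎
      where open ≡-Reasoning

  π₃ : Permutation′ n
  π₃ = flip τ²E ∘ₚ allFin-lookup

  π₃-τ²E : ∀ j → π₃ ⟨$⟩ʳ (τ²E ⟨$⟩ʳ j) ≡ E j
  π₃-τ²E j = cong E (inverseˡ τ²E)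

  endsAt-rhoIs⇒≈π₃ : ∀ {π} → EndsAt S π 3 × RhoIs S π 3 → π₃ ≈ₚ π
  endsAt-rhoIs⇒≈π₃ {π} ((hit , _) , (_ , miss)) = ∀-by-⟨$⟩ʳ τ²E (λ x → π₃ ⟨$⟩ʳ x ≡ π ⟨$⟩ʳ x) λ j → begin
    π₃ ⟨$⟩ʳ (τ²E ⟨$⟩ʳ j) ≡⟨ π₃-τ²E j ⟩
    E j                  ≡⟨ guess₃-misses π (miss 1 (s≤s z≤n) (s≤s (s≤s z≤n))) (miss 2 (s≤s z≤n) ≤-refl) j ⟨
    guess S π 3 (τ²E ⟨$⟩ʳ j) ≡⟨ hit (τ²E ⟨$⟩ʳ j) ⟩
    π ⟨$⟩ʳ (τ²E ⟨$⟩ʳ j)  ∎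
    where open ≡-Reasoning

  module _ (τ²-fpf : ∀ j → τ ⟨$⟩ʳ (τ ⟨$⟩ʳ j) ≢ j) where

    π₃-misses₁ : ¬ SomeCorrect S π₃ 1
    π₃-misses₁ (x , p) = ∀-by-⟨$⟩ʳ τ²E (λ x → x ≢ π₃ ⟨$⟩ʳ x)
      (λ j q → τ²-fpf j (⟨$⟩ʳ-injective allFin-lookup (trans q (π₃-τ²E j)))) x p

    π₃-misses₂ : ¬ SomeCorrect S π₃ 2
    π₃-misses₂ (x , p) = ∀-by-⟨$⟩ʳ τ²E (λ x → guess S π₃ 2 x ≢ π₃ ⟨$⟩ʳ x)
      (λ j q → τ²-fpf j (fixed⇒square-fixed (⟨$⟩ʳ-injective allFin-lookup
        (trans (sym (step-misses π₃ id π₃-misses₁ (τ ⟨$⟩ʳ j))) (trans q (π₃-τ²E j)))))) x p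
      where
        fixed⇒square-fixed : ∀ {j} → τ ⟨$⟩ʳ j ≡ j → τ ⟨$⟩ʳ (τ ⟨$⟩ʳ j) ≡ j
        fixed⇒square-fixed p = trans (cong (τ ⟨$⟩ʳ_) p) p

    π₃-endsAt-rhoIs : Fin n → EndsAt S π₃ 3 × RhoIs S π₃ 3
    π₃-endsAt-rhoIs i = endsAt×rhoIs i
      (∀-by-⟨$⟩ʳ τ²E _ λ j → trans (guess₃-misses π₃ π₃-misses₁ π₃-misses₂ j) (sym (π₃-τ²E j)))
      (below-3 π₃-misses₁ π₃-misses₂)

  ∃!-endsAt-rhoIs : Fin n → (∀ j → τ ⟨$⟩ʳ (τ ⟨$⟩ʳ j) ≢ j) →
    ∃! _≈ₚ_ (λ π → EndsAt S π 3 × RhoIs S π 3)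
  ∃!-endsAt-rhoIs i τ²-fpf = π₃ , π₃-endsAt-rhoIs τ²-fpf i , endsAt-rhoIs⇒≈π₃

theorem4p6 : (n : ℕ) → 4 ≤ n → (S : Strategy n) → CyclicStrategy S →
    ∃! _≈ₚ_ (λ (π : Permutation′ n) → EndsAt S π 3 × RhoIs S π 3)
theorem4p6 _ (s≤s (s≤s (s≤s (s≤s _)))) S cyclicS =
  ∃!-endsAt-rhoIs S fzero (cyclic⇒square-fixedPointFree (cyclicS _ (s≤s z≤n) (N≤n S)))
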